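{- Let $P$ and $Q$ be Motzkin paths of the same length with the same class, written $P=X_1D^{\gamma_1}\cdots X_\ell D^{\gamma_\ell}$ and $Q=X_1D^{\gamma'_1}\cdots X_\ell D^{\gamma'_\ell}$ with $X_i\in\{U,E\}$ and $\gamma_i,\gamma'_i\geq 0$, and suppose $P\leq_C Q$. Assume $P\not\leq_T Q$ and fix $i\in[\ell]$ with $\mathrm{lng}_i(P)>\mathrm{lng}_i(Q)$. Then there is $k\geq 0$ (with $i+k\leq\ell$) such that (i) $\gamma_i+\cdots+\gamma_{i+k}<\gamma'_i+\cdots+\gamma'_{i+k}$, and (ii) for all $j$ with $0\leq j\leq k$, $\gamma_i+\cdots+\gamma_{i+j}<\delta(X_i)+\cdots+\delta(X_{i+j})$.
   Context: A Motzkin path is a word in $\{U,D,E\}$ with equally many $U$'s and $D$'s such that every prefix has at least as many $U$'s as $D$'s. $\delta(U)=1$, $\delta(E)=0$, $\delta(D)=-1$. The class of a path is its subsequence of $U$'s and $E$'s. $P\le_S Q$ means that for every $m$ the height ($\#U-\#D$) of $P_1\cdots P_m$ is at most that of $Q_1\cdots Q_m$; $P\leq_C Q$ means same class and $P\leq_S Q$. For $P=X_1D^{\gamma_1}\cdots X_\ell D^{\gamma_\ell}$, $\mathrm{lng}_i(P)$ is the length of the shortest consecutive substring of $P$ starting at $X_i$ that is itself a Motzkin path. $P\leq_T Q$ means $P,Q$ have the same class and $\mathrm{lng}_i(P)\leq\mathrm{lng}_i(Q)$ for all $i\in[\ell]$. -}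

module Defs where

open import Data.Nat using (ℕ; zero; suc; _+_; _≤_; _<_)
open import Data.Integer using (ℤ; +_; -_; -[1+_]) renaming (_+_ to _+ℤ_; _≤_ to _≤ℤ_)
open import Data.List using (List; []; _∷_; _++_; take; drop; length; replicate; filterᵇ; map; foldr)
open import Data.Vec using (Vec; toList; lookup)
open import Data.Fin using (Fin; toℕ)
open import Data.Bool using (Bool; true; false)
open import Data.Product using (_×_)
open import Relation.Binary.PropositionalEquality using (_≡_)
open import Relation.Nullary using (¬_)

data Step : Set where
  U E D : Step

δ : Step → ℤ
δ U = + 1
δ E = + 0
δ D = -[1+ 0 ]

height : List Step → ℤ
height = foldr (λ s h → δ s +ℤ h) (+ 0)

Motzkin : List Step → Set
Motzkin w = (∀ m → + 0 ≤ℤ height (take m w)) × height w ≡ + 0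

isNotD : Step → Bool
isNotD D = false
isNotD _ = true

class : List Step → List Step
class = filterᵇ isNotD

_≤S_ : List Step → List Step → Set
P ≤S Q = ∀ m → height (take m P) ≤ℤ height (take m Q)

_≤C_ : List Step → List Step → Set
P ≤C Q = class P ≡ class Q × P ≤S Q

data Letter : Set where
  xU xE : Letter

toStep : Letter → Step
toStep xU = U
toStep xE = E

δL : Letter → ℤ
δL x = δ (toStep x)

build : List Letter → List ℕ → List Step
build (x ∷ xs) (g ∷ gs) = toStep x ∷ replicate g D ++ build xs gs
build _ _ = []

path : ∀ {ℓ} → Vec Letter ℓ → Vec ℕ ℓ → List Step
path X γ = build (toList X) (toList γ)

prefSum : ∀ {ℓ} → Vec ℕ ℓ → ℕ → ℕ
prefSum γ n = sumFirst (toList γ) n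
  where
  sumFirst : List ℕ → ℕ → ℕ
  sumFirst _ zero = 0
  sumFirst [] (suc n) = 0
  sumFirst (g ∷ gs) (suc n) = g + sumFirst gs n

-- position (0-based) of the letter X_i in the word X_1 D^{γ_1} ⋯ X_ℓ D^{γ_ℓ}
posX : ∀ {ℓ} → Vec ℕ ℓ → Fin ℓ → ℕ
posX γ i = toℕ i + prefSum γ (toℕ i)

IsLngAt : List Step → ℕ → ℕ → Set
IsLngAt w s n =
  1 ≤ n × s + n ≤ length w × Motzkin (take n (drop s w)) ×
  (∀ m → 1 ≤ m → m < n → ¬ Motzkin (take m (drop s w)))

IsLng : ∀ {ℓ} → Vec Letter ℓ → Vec ℕ ℓ → Fin ℓ → ℕ → Set
IsLng X γ i n = IsLngAt (path X γ) (posX γ i) n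

LeqT : ∀ {ℓ} → Vec Letter ℓ → Vec ℕ ℓ → Vec ℕ ℓ → Set
LeqT X γ γ' = ∀ i a b → IsLng X γ i a → IsLng X γ' i b → a ≤ b

rangeSum : (ℕ → ℤ) → ℕ → ℕ → ℤ
rangeSum f i zero = f i
rangeSum f i (suc j) = rangeSum f i j +ℤ f (i + suc j)

-- total extension of a vector by 0 outside its range
γAt : ∀ {ℓ} → Vec ℕ ℓ → ℕ → ℤ
γAt γ n = + at (toList γ) n
  where
  at : List ℕ → ℕ → ℕ
  at [] _ = 0
  at (g ∷ gs) zero = g
  at (g ∷ gs) (suc n) = at gs n

δAt : ∀ {ℓ} → Vec Letter ℓ → ℕ → ℤ
δAt X n = at (toList X) n
  where
  at : List Letter → ℕ → ℤ
  at [] _ = + 0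
  at (x ∷ xs) zero = δL x
  at (x ∷ xs) (suc n) = at xs n

module Submission where

-- Cut both paths at the letter X_i: the suffixes are
-- w = X_i D^{γ_i} X_{i+1} ⋯ and w' = X_i D^{γ'_i} ⋯, and lng_i(P) = a,
-- lng_i(Q) = b are the lengths of the shortest nonempty Motzkin prefixes.
-- Let c be the number of letters X in the Motzkin prefix of w' of length b;
-- then b = c + (number of U's among X_i ⋯ X_{i+c-1}).
--  (ii) If for some 1 ≤ c₀ ≤ c the first c₀ blocks of w contained at least as
--       many D's as U's, the height of w would drop to ≤ 0 inside them, so w
--       would have a Motzkin prefix with at most c₀ letters, of length
--       ≤ c + #U ≤ b < a, contradicting the minimality of a.
--  (i)  γ-sum < δ-sum (by (ii) at c₀ = c) = #U = #D in the prefix of w' ≤ γ'-sum.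
-- The witness is k = c - 1; only the minimality of lng_i(P) and the Motzkin
-- prefix of Q realising lng_i(Q) are needed.

open import Defs
open import Data.Nat using (ℕ; zero; suc; _+_; _∸_; _⊓_; _≤_; _<_; _>_; z≤n; s≤s)
import Data.Nat.Properties as NP
open import Data.Nat.ListAction using (sum)
open import Data.Integer using (+_; -[1+_]; +≤+; -≤+; +<+)
  renaming (_+_ to _+ℤ_; _≤_ to _≤ℤ_; _<_ to _<ℤ_)
import Data.Integer.Properties as ZP
open import Data.List using (List; []; _∷_; _++_; length; take; drop; replicate; map)
import Data.List.Properties as LP
open import Data.Vec using (Vec; toList) renaming ([] to []v; _∷_ to _∷v_)
import Data.Vec.Properties as VP
open import Data.Fin using (Fin; toℕ)
import Data.Fin.Properties as FP
open import Data.Sum using (_⊎_; inj₁; inj₂)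
open import Data.Product using (_×_; _,_; proj₂; ∃-syntax)
open import Data.Empty using (⊥-elim)
open import Relation.Binary.PropositionalEquality
  using (_≡_; refl; sym; trans; cong; cong₂; subst; subst₂; module ≡-Reasoning)
open import Relation.Nullary using (¬_; yes; no)

tally : (Step → ℕ) → List Step → ℕ
tally f [] = 0
tally f (s ∷ w) = f s + tally f w

isU isD isX : Step → ℕ
isU U = 1
isU _ = 0
isD D = 1
isD _ = 0
isX D = 0
isX _ = 1

#U #D #X : List Step → ℕ
#U = tally isU
#D = tally isD
#X = tally isX

isX-letter : ∀ x → isX (toStep x) ≡ 1
isX-letter xU = refl
isX-letter xE = refl

isD-letter : ∀ x → isD (toStep x) ≡ 0
isD-letter xU = refl
isD-letter xE = refl

length-tally : ∀ w → length w ≡ #X w + #D w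
length-tally [] = refl
length-tally (U ∷ w) = cong suc (length-tally w)
length-tally (E ∷ w) = cong suc (length-tally w)
length-tally (D ∷ w) = trans (cong suc (length-tally w)) (sym (NP.+-suc (#X w) (#D w)))

tally-take-mono : ∀ f w {m L} → m ≤ L → tally f (take m w) ≤ tally f (take L w)
tally-take-mono f w z≤n = z≤n
tally-take-mono f [] (s≤s m≤L) = z≤n
tally-take-mono f (s ∷ w) (s≤s m≤L) = NP.+-monoʳ-≤ (f s) (tally-take-mono f w m≤L)

height-tally : ∀ w → height w +ℤ + #D w ≡ + #U w
height-tally [] = refl
height-tally (U ∷ w) =
  trans (ZP.+-assoc (+ 1) (height w) (+ #D w)) (cong (+ 1 +ℤ_) (height-tally w))
height-tally (E ∷ w) =
  trans (cong (_+ℤ + #D w) (ZP.+-identityˡ (height w))) (height-tally w)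
height-tally (D ∷ w) = begin
  (-[1+ 0 ] +ℤ height w) +ℤ + suc (#D w) ≡⟨ cong (_+ℤ + suc (#D w)) (ZP.+-comm -[1+ 0 ] (height w)) ⟩
  (height w +ℤ -[1+ 0 ]) +ℤ + suc (#D w) ≡⟨ ZP.+-assoc (height w) -[1+ 0 ] (+ suc (#D w)) ⟩
  height w +ℤ + #D w                     ≡⟨ height-tally w ⟩
  + #U w                                 ∎
  where open ≡-Reasoning

balanced : ∀ w → height w ≡ + 0 → #U w ≡ #D w
balanced w h≡0 = sym (ZP.+-injective (begin
  + #D w                ≡⟨ sym (ZP.+-identityˡ (+ #D w)) ⟩
  + 0 +ℤ + #D w         ≡⟨ cong (_+ℤ + #D w) (sym h≡0) ⟩
  height w +ℤ + #D w    ≡⟨ height-tally w ⟩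
  + #U w                ∎))
  where open ≡-Reasoning

-- If h + d = u with u ≤ d then h ≤ 0; combined with height-tally, a word with
-- #U ≤ #D has height ≤ 0.
nonpositive : ∀ h d u → h +ℤ + d ≡ + u → u ≤ d → h ≤ℤ + 0
nonpositive (+ zero) d u _ _ = +≤+ z≤n
nonpositive (+ suc n) d u eq u≤d =
  ⊥-elim (NP.<⇒≱ (NP.≤-trans (NP.+-monoˡ-≤ d (s≤s z≤n)) (NP.≤-reflexive (ZP.+-injective eq))) u≤d)
nonpositive -[1+ n ] d u _ _ = -≤+

height-step : ∀ w L → height (take L w) ≤ℤ height (take (suc L) w) +ℤ + 1
height-step [] L rewrite LP.take-[] {A = Step} L = +≤+ z≤n
height-step (U ∷ w) zero = +≤+ z≤n
height-step (E ∷ w) zero = +≤+ z≤n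
height-step (D ∷ w) zero = +≤+ z≤n
height-step (s ∷ w) (suc L) =
  ZP.≤-trans (ZP.+-monoʳ-≤ (δ s) (height-step w L))
    (ZP.≤-reflexive (sym (ZP.+-assoc (δ s) (height (take (suc L) w)) (+ 1))))

pred-nonneg : ∀ z → + 1 ≤ℤ z +ℤ + 1 → + 0 ≤ℤ z
pred-nonneg (+ n) _ = +≤+ z≤n
pred-nonneg -[1+ zero ] (+≤+ ())
pred-nonneg -[1+ suc n ] ()

nonneg-not-pos : ∀ z → + 0 ≤ℤ z → ¬ (+ 1 ≤ℤ z) → z ≡ + 0
nonneg-not-pos (+ zero) _ _ = refl
nonneg-not-pos (+ suc n) _ ¬pos = ⊥-elim (¬pos (+≤+ (s≤s z≤n)))

motzkin-take : ∀ w n → (∀ m → m ≤ n → + 0 ≤ℤ height (take m w)) →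
  height (take n w) ≡ + 0 → Motzkin (take n w)
motzkin-take w n nonneg h≡0 = prefixes , h≡0
  where
  prefixes : ∀ m → + 0 ≤ℤ height (take m (take n w))
  prefixes m rewrite LP.take-take m n w = nonneg (m ⊓ n) (NP.m⊓n≤n m n)

first-return : ∀ w → + 0 ≤ℤ height (take 1 w) → ∀ L →
  (∀ m → 1 ≤ m → m ≤ L → + 1 ≤ℤ height (take m w)) ⊎
  (∃[ m ] (1 ≤ m × m ≤ L × Motzkin (take m w)))
first-return w start zero = inj₁ (λ { m 1≤m m≤0 → ⊥-elim (NP.<⇒≱ 1≤m m≤0) })
first-return w start (suc L) with first-return w start L
... | inj₂ (m , 1≤m , m≤L , motzkin) = inj₂ (m , 1≤m , NP.m≤n⇒m≤1+n m≤L , motzkin)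
... | inj₁ positive with + 1 ZP.≤? height (take (suc L) w)
...   | yes pos = inj₁ extended
  where
  extended : ∀ m → 1 ≤ m → m ≤ suc L → + 1 ≤ℤ height (take m w)
  extended m 1≤m m≤1+L with NP.m≤n⇒m<n∨m≡n m≤1+L
  ... | inj₁ (s≤s m≤L) = positive m 1≤m m≤L
  ... | inj₂ refl = pos
...   | no ¬pos = inj₂ (suc L , s≤s z≤n , NP.≤-refl ,
                        motzkin-take w (suc L) nonneg (nonneg-not-pos _ (last L positive) ¬pos))
  where
  last : ∀ L → (∀ m → 1 ≤ m → m ≤ L → + 1 ≤ℤ height (take m w)) → + 0 ≤ℤ height (take (suc L) w)
  last zero _ = start
  last (suc L) pos = pred-nonneg _ (ZP.≤-trans (pos (suc L) (s≤s z≤n) NP.≤-refl) (height-step w (suc L)))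
  nonneg : ∀ m → m ≤ suc L → + 0 ≤ℤ height (take m w)
  nonneg zero _ = +≤+ z≤n
  nonneg (suc m) m<2+L with NP.m≤n⇒m<n∨m≡n m<2+L
  ... | inj₁ (s≤s m<1+L) = ZP.≤-trans (+≤+ z≤n) (positive (suc m) (s≤s z≤n) m<1+L)
  ... | inj₂ refl = last L positive

motzkin-prefix : ∀ w L → + 0 ≤ℤ height (take 1 w) → 1 ≤ L → height (take L w) ≤ℤ + 0 →
  ∃[ m ] (1 ≤ m × m ≤ L × Motzkin (take m w))
motzkin-prefix w L start 1≤L drop≤0 with first-return w start L
... | inj₂ found = found
... | inj₁ positive =
  ⊥-elim (NP.<-irrefl refl (ZP.drop‿+≤+ (ZP.≤-trans (positive L 1≤L NP.≤-refl) drop≤0)))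

-- The words X₁D^{g₁}⋯X_ℓD^{g_ℓ}, described block by block.  rises xs lists
-- δ(X₁), δ(X₂), … , so sum (take c (rises xs)) is the number of U's among
-- the first c letters.
rises : List Letter → List ℕ
rises = map (λ x → isU (toStep x))

letter-start : ∀ x w → + 0 ≤ℤ height (take 1 (toStep x ∷ w))
letter-start xU w = +≤+ z≤n
letter-start xE w = +≤+ z≤n

tally-after-Ds : ∀ f → f D ≡ 0 → ∀ g m r →
  tally f (take m (replicate g D ++ r)) ≡ tally f (take (m ∸ g) r)
tally-after-Ds f f0 zero m r = refl
tally-after-Ds f f0 (suc g) zero r = refl
tally-after-Ds f f0 (suc g) (suc m) r rewrite f0 = tally-after-Ds f f0 g m r

tally-after-all-Ds : ∀ f → f D ≡ 0 → ∀ g N r →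
  tally f (take (g + N) (replicate g D ++ r)) ≡ tally f (take N r)
tally-after-all-Ds f f0 g N r =
  trans (tally-after-Ds f f0 g (g + N) r) (cong (λ n → tally f (take n r)) (NP.m+n∸m≡n g N))

downs-after-Ds : ∀ g m r → #D (take m (replicate g D ++ r)) ≤ g + #D (take (m ∸ g) r)
downs-after-Ds zero m r = NP.≤-refl
downs-after-Ds (suc g) zero r = z≤n
downs-after-Ds (suc g) (suc m) r = s≤s (downs-after-Ds g m r)

downs-after-all-Ds : ∀ g N r → #D (take (g + N) (replicate g D ++ r)) ≡ g + #D (take N r)
downs-after-all-Ds zero N r = refl
downs-after-all-Ds (suc g) N r = cong suc (downs-after-all-Ds g N r)

prefix-ups : ∀ xs gs m →
  #U (take m (build xs gs)) ≡ sum (take (#X (take m (build xs gs))) (rises xs))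
prefix-ups [] gs m rewrite LP.take-[] {A = Step} m = refl
prefix-ups (x ∷ xs) [] m rewrite LP.take-[] {A = Step} m = refl
prefix-ups (x ∷ xs) (g ∷ gs) zero = refl
prefix-ups (x ∷ xs) (g ∷ gs) (suc m) rewrite isX-letter x = cong (λ n → isU (toStep x) + n) (begin
  #U (take m (replicate g D ++ r))                   ≡⟨ tally-after-Ds isU refl g m r ⟩
  #U (take (m ∸ g) r)                                ≡⟨ prefix-ups xs gs (m ∸ g) ⟩
  sum (take (#X (take (m ∸ g) r)) (rises xs))        ≡⟨ cong (λ c → sum (take c (rises xs)))
                                                          (sym (tally-after-Ds isX refl g m r)) ⟩
  sum (take (#X (take m (replicate g D ++ r))) (rises xs)) ∎)
  where
  r : List Step
  r = build xs gs
  open ≡-Reasoning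

prefix-downs : ∀ xs gs m →
  #D (take m (build xs gs)) ≤ sum (take (#X (take m (build xs gs))) gs)
prefix-downs [] gs m rewrite LP.take-[] {A = Step} m = z≤n
prefix-downs (x ∷ xs) [] m rewrite LP.take-[] {A = Step} m = z≤n
prefix-downs (x ∷ xs) (g ∷ gs) zero = z≤n
prefix-downs (x ∷ xs) (g ∷ gs) (suc m) rewrite isX-letter x | isD-letter x = begin
  #D (take m (replicate g D ++ r))                   ≤⟨ downs-after-Ds g m r ⟩
  g + #D (take (m ∸ g) r)                            ≤⟨ NP.+-monoʳ-≤ g (prefix-downs xs gs (m ∸ g)) ⟩
  g + sum (take (#X (take (m ∸ g) r)) gs)            ≡⟨ cong (λ c → g + sum (take c gs))
                                                          (sym (tally-after-Ds isX refl g m r)) ⟩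
  g + sum (take (#X (take m (replicate g D ++ r))) gs) ∎
  where
  r : List Step
  r = build xs gs
  open NP.≤-Reasoning

prefix-letters : ∀ xs gs m → #X (take m (build xs gs)) ≤ length xs
prefix-letters [] gs m rewrite LP.take-[] {A = Step} m = z≤n
prefix-letters (x ∷ xs) [] m rewrite LP.take-[] {A = Step} m = z≤n
prefix-letters (x ∷ xs) (g ∷ gs) zero = z≤n
prefix-letters (x ∷ xs) (g ∷ gs) (suc m) rewrite isX-letter x =
  s≤s (subst (_≤ length xs) (sym (tally-after-Ds isX refl g m (build xs gs)))
         (prefix-letters xs gs (m ∸ g)))

motzkin-prefix-length : ∀ xs gs m → m ≤ length (build xs gs) → Motzkin (take m (build xs gs)) →
  m ≡ #X (take m (build xs gs)) + sum (take (#X (take m (build xs gs))) (rises xs))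
motzkin-prefix-length xs gs m m≤len (_ , h≡0) = begin
  m                  ≡⟨ sym (NP.m≤n⇒m⊓n≡m m≤len) ⟩
  m ⊓ length w       ≡⟨ sym (LP.length-take m w) ⟩
  length t           ≡⟨ length-tally t ⟩
  #X t + #D t        ≡⟨ cong (λ n → #X t + n) (sym (balanced t h≡0)) ⟩
  #X t + #U t        ≡⟨ cong (λ n → #X t + n) (prefix-ups xs gs m) ⟩
  #X t + sum (take (#X t) (rises xs)) ∎
  where
  w t : List Step
  w = build xs gs
  t = take m w
  open ≡-Reasoning

blockEnd : ℕ → List ℕ → ℕ
blockEnd zero _ = 0
blockEnd (suc c) [] = 0
blockEnd (suc c) (g ∷ gs) = suc (g + blockEnd c gs)

record BlockCounts (xs : List Letter) (gs : List ℕ) (c : ℕ) : Set where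
  field
    ups     : #U (take (blockEnd c gs) (build xs gs)) ≡ sum (take c (rises xs))
    downs   : #D (take (blockEnd c gs) (build xs gs)) ≡ sum (take c gs)
    letters : #X (take (blockEnd c gs) (build xs gs)) ≤ c

block-counts : ∀ c xs gs → length xs ≡ length gs → BlockCounts xs gs c
block-counts zero xs gs _ = record { ups = refl ; downs = refl ; letters = z≤n }
block-counts (suc c) [] [] _ = record { ups = refl ; downs = refl ; letters = z≤n }
block-counts (suc c) (x ∷ xs) (g ∷ gs) same = record
  { ups     = cong (λ n → isU (toStep x) + n) (trans (tally-after-all-Ds isU refl g B r) ups)
  ; downs   = cong₂ _+_ (isD-letter x) (trans (downs-after-all-Ds g B r) (cong (λ n → g + n) downs))
  ; letters = subst (λ n → n + #X t ≤ suc c) (sym (isX-letter x))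
                (s≤s (subst (_≤ c) (sym (tally-after-all-Ds isX refl g B r)) letters))
  }
  where
  r : List Step
  r = build xs gs
  B : ℕ
  B = blockEnd c gs
  t : List Step
  t = take (g + B) (replicate g D ++ r)
  open BlockCounts (block-counts c xs gs (NP.suc-injective same))

blockEnd-bound : ∀ c xs gs → length xs ≡ length gs → blockEnd c gs ≤ length (build xs gs)
blockEnd-bound zero xs gs _ = z≤n
blockEnd-bound (suc c) [] [] _ = z≤n
blockEnd-bound (suc c) (x ∷ xs) (g ∷ gs) same = s≤s (begin
  g + blockEnd c gs                        ≤⟨ NP.+-monoʳ-≤ g (blockEnd-bound c xs gs (NP.suc-injective same)) ⟩
  g + length r                             ≡⟨ cong (_+ length r) (sym (LP.length-replicate g)) ⟩
  length (replicate g D) + length r        ≡⟨ sym (LP.length-++ (replicate g D)) ⟩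
  length (replicate g D ++ r)              ∎)
  where
  r : List Step
  r = build xs gs
  open NP.≤-Reasoning

sum-take-mono : ∀ (ns : List ℕ) {c c'} → c ≤ c' → sum (take c ns) ≤ sum (take c' ns)
sum-take-mono ns z≤n = z≤n
sum-take-mono [] (s≤s c≤c') = z≤n
sum-take-mono (n ∷ ns) (s≤s c≤c') = NP.+-monoʳ-≤ n (sum-take-mono ns c≤c')

return-within-blocks : ∀ xs gs → length xs ≡ length gs → ∀ c → 1 ≤ c → c ≤ length xs →
  sum (take c (rises xs)) ≤ sum (take c gs) →
  ∃[ m ] (1 ≤ m × m ≤ length (build xs gs) ×
          #X (take m (build xs gs)) ≤ c × Motzkin (take m (build xs gs)))
return-within-blocks [] [] _ c 1≤c c≤0 _ = ⊥-elim (NP.<⇒≱ 1≤c c≤0)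
return-within-blocks (x ∷ xs) (g ∷ gs) same c@(suc _) _ _ ups≤downs =
  let (m , 1≤m , m≤L , motzkin) = motzkin-prefix w L start (s≤s z≤n) height≤0
  in m , 1≤m , NP.≤-trans m≤L (blockEnd-bound c (x ∷ xs) (g ∷ gs) same) ,
     NP.≤-trans (tally-take-mono isX w m≤L) letters , motzkin
  where
  w : List Step
  w = build (x ∷ xs) (g ∷ gs)
  L : ℕ
  L = blockEnd c (g ∷ gs)
  start : + 0 ≤ℤ height (take 1 w)
  start = letter-start x (replicate g D ++ build xs gs)
  open BlockCounts (block-counts c (x ∷ xs) (g ∷ gs) same)
  height≤0 : height (take L w) ≤ℤ + 0
  height≤0 = nonpositive _ _ _
    (trans (cong (λ n → height (take L w) +ℤ + n) (sym downs))
           (trans (height-tally (take L w)) (cong +_ ups)))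
    ups≤downs

deficit-before-return : ∀ xs gs gs' a b → length xs ≡ length gs →
  (∀ m → 1 ≤ m → m < a → ¬ Motzkin (take m (build xs gs))) →
  b ≤ length (build xs gs') → Motzkin (take b (build xs gs')) → b < a →
  ∀ c₀ → 1 ≤ c₀ → c₀ ≤ #X (take b (build xs gs')) →
  sum (take c₀ gs) < sum (take c₀ (rises xs))
deficit-before-return xs gs gs' a b same a-minimal b≤len b-motzkin b<a c₀ 1≤c₀ c₀≤c =
  NP.≰⇒> no-early-return
  where
  c : ℕ
  c = #X (take b (build xs gs'))
  no-early-return : ¬ (sum (take c₀ (rises xs)) ≤ sum (take c₀ gs))
  no-early-return ups≤downs
    with return-within-blocks xs gs same c₀ 1≤c₀ (NP.≤-trans c₀≤c (prefix-letters xs gs' b)) ups≤downs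
  ... | m , 1≤m , m≤len , cm≤c₀ , m-motzkin = NP.<⇒≱ b<a (NP.≤-trans a≤m m≤b)
    where
    cm : ℕ
    cm = #X (take m (build xs gs))
    cm≤c : cm ≤ c
    cm≤c = NP.≤-trans cm≤c₀ c₀≤c
    a≤m : a ≤ m
    a≤m = NP.≮⇒≥ (λ m<a → a-minimal m 1≤m m<a m-motzkin)
    -- a Motzkin prefix with fewer letters is not longer
    m≤b : m ≤ b
    m≤b = begin
      m                                   ≡⟨ motzkin-prefix-length xs gs m m≤len m-motzkin ⟩
      cm + sum (take cm (rises xs))       ≤⟨ NP.+-mono-≤ cm≤c (sum-take-mono (rises xs) cm≤c) ⟩
      c + sum (take c (rises xs))         ≡⟨ sym (motzkin-prefix-length xs gs' b b≤len b-motzkin) ⟩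
      b                                   ∎
      where open NP.≤-Reasoning

block-witness : ∀ xs gs gs' a b → length xs ≡ length gs →
  (∀ m → 1 ≤ m → m < a → ¬ Motzkin (take m (build xs gs))) →
  1 ≤ b → b ≤ length (build xs gs') → Motzkin (take b (build xs gs')) → b < a →
  ∃[ c ] (1 ≤ c × c ≤ length xs × sum (take c gs) < sum (take c gs') ×
          (∀ c₀ → 1 ≤ c₀ → c₀ ≤ c → sum (take c₀ gs) < sum (take c₀ (rises xs))))
block-witness xs gs gs' a b same a-minimal 1≤b b≤len b-motzkin b<a =
  c , 1≤c , prefix-letters xs gs' b , fewer-downs , deficit
  where
  t : List Step
  t = take b (build xs gs')
  c : ℕ
  c = #X t
  b≡ : b ≡ c + sum (take c (rises xs))
  b≡ = motzkin-prefix-length xs gs' b b≤len b-motzkin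
  1≤c : 1 ≤ c
  1≤c = NP.n≢0⇒n>0 (λ c≡0 →
    NP.m<n⇒n≢0 1≤b (subst (λ k → b ≡ k + sum (take k (rises xs))) c≡0 b≡))
  deficit : ∀ c₀ → 1 ≤ c₀ → c₀ ≤ c → sum (take c₀ gs) < sum (take c₀ (rises xs))
  deficit = deficit-before-return xs gs gs' a b same a-minimal b≤len b-motzkin b<a
  fewer-downs : sum (take c gs) < sum (take c gs')
  fewer-downs = begin-strict
    sum (take c gs)          <⟨ deficit c 1≤c NP.≤-refl ⟩
    sum (take c (rises xs))  ≡⟨ sym (prefix-ups xs gs' b) ⟩
    #U t                     ≡⟨ balanced t (proj₂ b-motzkin) ⟩
    #D t                     ≤⟨ prefix-downs xs gs' b ⟩
    sum (take c gs')         ∎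
    where open NP.≤-Reasoning

entry : List ℕ → ℕ → ℕ
entry [] _ = 0
entry (n ∷ ns) zero = n
entry (n ∷ ns) (suc t) = entry ns t

γAt-entry : ∀ {ℓ} (γ : Vec ℕ ℓ) t → γAt γ t ≡ + entry (toList γ) t
γAt-entry []v t = refl
γAt-entry (g ∷v γ) zero = refl
γAt-entry (g ∷v γ) (suc t) = γAt-entry γ t

δL-rise : ∀ x → δL x ≡ + isU (toStep x)
δL-rise xU = refl
δL-rise xE = refl

δAt-entry : ∀ {ℓ} (X : Vec Letter ℓ) t → δAt X t ≡ + entry (rises (toList X)) t
δAt-entry []v t = refl
δAt-entry (x ∷v X) zero = δL-rise x
δAt-entry (x ∷v X) (suc t) = δAt-entry X t

entry-drop : ∀ n ns t → entry (drop n ns) t ≡ entry ns (n + t)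
entry-drop zero ns t = refl
entry-drop (suc n) [] t = refl
entry-drop (suc n) (m ∷ ns) t = entry-drop n ns t

sum-take-suc : ∀ ns c → sum (take (suc c) ns) ≡ sum (take c ns) + entry ns c
sum-take-suc [] zero = refl
sum-take-suc [] (suc c) = refl
sum-take-suc (n ∷ ns) zero = NP.+-comm n 0
sum-take-suc (n ∷ ns) (suc c) =
  trans (cong (λ s → n + s) (sum-take-suc ns c)) (sym (NP.+-assoc n _ (entry ns c)))

rangeSum-sum : ∀ f i ns → (∀ t → f (i + t) ≡ + entry ns t) →
  ∀ j → rangeSum f i j ≡ + sum (take (suc j) ns)
rangeSum-sum f i ns f≡ zero =
  trans (cong f (sym (NP.+-identityʳ i))) (trans (f≡ 0) (cong +_ (sym (sum-take-suc ns 0))))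
rangeSum-sum f i ns f≡ (suc j) =
  trans (cong₂ _+ℤ_ (rangeSum-sum f i ns f≡ j) (f≡ (suc j)))
        (cong +_ (sym (sum-take-suc ns (suc j))))

γ-range : ∀ {ℓ} (γ : Vec ℕ ℓ) n j →
  rangeSum (γAt γ) n j ≡ + sum (take (suc j) (drop n (toList γ)))
γ-range γ n j = rangeSum-sum (γAt γ) n (drop n (toList γ))
  (λ t → trans (γAt-entry γ (n + t)) (cong +_ (sym (entry-drop n (toList γ) t)))) j

δ-range : ∀ {ℓ} (X : Vec Letter ℓ) n j →
  rangeSum (δAt X) n j ≡ + sum (take (suc j) (rises (drop n (toList X))))
δ-range X n j = rangeSum-sum (δAt X) n (rises (drop n (toList X)))
  (λ t → trans (δAt-entry X (n + t))
           (cong +_ (trans (sym (entry-drop n (rises (toList X)) t))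
                           (cong (λ ns → entry ns t) (LP.drop-map n (toList X)))))) j

drop-path : ∀ {ℓ} (X : Vec Letter ℓ) (γ : Vec ℕ ℓ) n →
  drop (n + prefSum γ n) (path X γ) ≡ build (drop n (toList X)) (drop n (toList γ))
drop-path X γ zero = refl
drop-path []v []v (suc n) = refl
drop-path (x ∷v X) (g ∷v γ) (suc n) = begin
  drop (n + (g + prefSum γ n)) (replicate g D ++ path X γ)
    ≡⟨ cong (λ k → drop k (replicate g D ++ path X γ)) (NP.+-comm n (g + prefSum γ n)) ⟩
  drop ((g + prefSum γ n) + n) (replicate g D ++ path X γ)
    ≡⟨ cong (λ k → drop k (replicate g D ++ path X γ)) (NP.+-assoc g (prefSum γ n) n) ⟩
  drop (g + (prefSum γ n + n)) (replicate g D ++ path X γ)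
    ≡⟨ drop-after-Ds g (prefSum γ n + n) (path X γ) ⟩
  drop (prefSum γ n + n) (path X γ)
    ≡⟨ cong (λ k → drop k (path X γ)) (NP.+-comm (prefSum γ n) n) ⟩
  drop (n + prefSum γ n) (path X γ)
    ≡⟨ drop-path X γ n ⟩
  build (drop n (toList X)) (drop n (toList γ)) ∎
  where
  open ≡-Reasoning
  drop-after-Ds : ∀ g N (r : List Step) → drop (g + N) (replicate g D ++ r) ≡ drop N r
  drop-after-Ds zero N r = refl
  drop-after-Ds (suc g) N r = drop-after-Ds g N r

length-drop-vec : ∀ {A : Set} {ℓ} (v : Vec A ℓ) n → length (drop n (toList v)) ≡ ℓ ∸ n
length-drop-vec v n = trans (LP.length-drop n (toList v)) (cong (_∸ n) (VP.length-toList v))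

suffix-witness : ∀ {ℓ} (X : Vec Letter ℓ) (γ γ' : Vec ℕ ℓ) (i : Fin ℓ) a b →
  IsLng X γ i a → IsLng X γ' i b → b < a →
  let xs = drop (toℕ i) (toList X)
      gs = drop (toℕ i) (toList γ)
      gs' = drop (toℕ i) (toList γ')
  in ∃[ c ] (1 ≤ c × c ≤ ℓ ∸ toℕ i × sum (take c gs) < sum (take c gs') ×
             (∀ c₀ → 1 ≤ c₀ → c₀ ≤ c → sum (take c₀ gs) < sum (take c₀ (rises xs))))
suffix-witness X γ γ' i a b (_ , _ , _ , a-minimal) (1≤b , b-fits , b-motzkin , _) b<a
  with block-witness xs gs gs' a b same a-minimal' 1≤b b-fits' b-motzkin' b<a
  where
  n : ℕ
  n = toℕ i
  xs : List Letter
  xs = drop n (toList X)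
  gs gs' : List ℕ
  gs = drop n (toList γ)
  gs' = drop n (toList γ')
  same : length xs ≡ length gs
  same = trans (length-drop-vec X n) (sym (length-drop-vec γ n))
  a-minimal' : ∀ m → 1 ≤ m → m < a → ¬ Motzkin (take m (build xs gs))
  a-minimal' m 1≤m m<a = subst (λ w → ¬ Motzkin (take m w)) (drop-path X γ n) (a-minimal m 1≤m m<a)
  b-motzkin' : Motzkin (take b (build xs gs'))
  b-motzkin' = subst (λ w → Motzkin (take b w)) (drop-path X γ' n) b-motzkin
  b-fits' : b ≤ length (build xs gs')
  b-fits' = subst (λ w → b ≤ length w) (drop-path X γ' n)
    (subst (b ≤_) (sym (LP.length-drop (posX γ' i) (path X γ')))
      (NP.m+n≤o⇒m≤o∸n b (subst (_≤ length (path X γ')) (NP.+-comm (posX γ' i) b) b-fits)))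
... | c , 1≤c , c≤len , fewer , deficit =
  c , 1≤c , subst (c ≤_) (length-drop-vec X (toℕ i)) c≤len , fewer , deficit

proposition7p1 : ∀ {ℓ} (X : Vec Letter ℓ) (γ γ' : Vec ℕ ℓ) →
    Motzkin (path X γ) → Motzkin (path X γ') →
    length (path X γ) ≡ length (path X γ') →
    path X γ ≤C path X γ' →
    ¬ LeqT X γ γ' →
    (i : Fin ℓ) (a b : ℕ) → IsLng X γ i a → IsLng X γ' i b → a > b →
    ∃[ k ] (toℕ i + k < ℓ ×
      rangeSum (γAt γ) (toℕ i) k <ℤ rangeSum (γAt γ') (toℕ i) k ×
      (∀ j → j ≤ k → rangeSum (γAt γ) (toℕ i) j <ℤ rangeSum (δAt X) (toℕ i) j))
proposition7p1 {ℓ} X γ γ' _ _ _ _ _ i a b lngP lngQ b<a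
  with suffix-witness X γ γ' i a b lngP lngQ b<a
... | suc k , _ , c≤ , fewer , deficit =
  k , in-range ,
  subst₂ _<ℤ_ (sym (γ-range γ (toℕ i) k)) (sym (γ-range γ' (toℕ i) k)) (+<+ fewer) ,
  λ j j≤k → subst₂ _<ℤ_ (sym (γ-range γ (toℕ i) j)) (sym (δ-range X (toℕ i) j))
                        (+<+ (deficit (suc j) (s≤s z≤n) (s≤s j≤k)))
  where
  in-range : toℕ i + k < ℓ
  in-range = subst (_≤ ℓ) (cong suc (NP.+-comm k (toℕ i)))
    (NP.m≤o∸n⇒m+n≤o (suc k) (NP.<⇒≤ (FP.toℕ<n i)) c≤)
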